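{- Let $A$ be a set of integers which contains at least one odd integer, and such that for every odd prime $p$ there exist $a_1,a_2\in A$ with $a_1\not\equiv a_2\pmod p$. Then there exists a sequence $(r_i)_{i\in\mathbb{N}}$ with $r_i\in A$ for all $i$ such that, for every $n\in\mathbb{N}$, the denominator (in lowest terms, taken positive) of $\sum_{i=1}^n r_i/i$ equals $\mathrm{lcm}(1,2,\dots,n)$. -}

module Defs where

open import Data.Nat as ℕ using (ℕ; zero; suc)
open import Data.Nat.LCM using (lcm)
open import Data.Integer as ℤ using (ℤ)
open import Data.Rational as ℚ using (ℚ; 0ℚ)

lcmUpTo : ℕ → ℕ
lcmUpTo zero    = 1
lcmUpTo (suc n) = lcm (lcmUpTo n) (suc n)

harmonicSum : (ℕ → ℤ) → ℕ → ℚ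
harmonicSum r zero    = 0ℚ
harmonicSum r (suc n) = harmonicSum r n ℚ.+ (r (suc n) ℚ./ suc n)

-- Write L n = lcmUpTo n and suppose Σ_{i ≤ n} r i / i = N / L n with N coprime to L n. With
-- g = gcd (L n) (n+1), α = L n / g and β = (n+1) / g we have L (n+1) = L n · β = (n+1) · α, so
-- adding c / (n+1) gives the fraction (N β + c α) / L (n+1). A prime dividing L (n+1) and α cannot
-- divide N β + c α, since it divides neither N nor β. The remaining primes, those dividing n+1 but
-- not α, are "critical", and there is at most one: a critical p divides every divisor d ≥ p of n+1,
-- so it is the largest prime factor of n+1. For an odd critical p, one of two elements of A that
-- are incongruent mod p keeps p out of the numerator. If 2 is critical then n+1 is a power of 2, so
-- β is even and the odd element of A works. Choosing every r (n+1) this way keeps each sum reduced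
-- with denominator L n.
module Submission where

open import Defs
open import Data.Nat as ℕ using (ℕ)
open import Data.Nat.Primality using (Prime)
open import Data.Integer as ℤ using (ℤ; +_; _-_)
open import Data.Integer.Divisibility using () renaming (_∣_ to _∣ᵤ_)
open import Data.Rational as ℚ using (ℚ)
open import Data.Product using (Σ; ∃; _×_; _,_)
open import Relation.Nullary using (¬_)
open import Relation.Binary.PropositionalEquality using (_≡_; _≢_)

module Fraction where

  open import Data.Nat as ℕ using (NonZero)
  open import Data.Nat.Properties using (m*n≢0)
  open import Data.Nat.Divisibility using (divides; ∣-antisym)
  open import Data.Nat.Coprimality as Coprimality using (Coprime; coprime-divisor)
  open import Data.Integer using (_+_; _*_; ∣_∣)
  import Data.Integer.Properties as ℤ
  open import Data.Integer.GCD as ℤ using ()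
  open import Data.Integer.Tactic.RingSolver using (solve-∀)
  open import Data.Rational using (mkℚ; ↥_; ↧_; ↧ₙ_)
  import Data.Rational.Properties as ℚ
  import Algebra.Properties.CommutativeSemigroup ℤ.*-commutativeSemigroup as ℤ*
  open import Relation.Binary.PropositionalEquality
  open ≡-Reasoning

  data IsFraction (h : ℚ) (N : ℤ) (d : ℕ) : Set where
    *≡* : ↥ h * + d ≡ N * ↧ h → IsFraction h N d

  /-isFraction : ∀ x d .{{_ : NonZero d}} → IsFraction (x ℚ./ d) x d
  /-isFraction x d = *≡* (begin
    ↥ q * + d          ≡⟨ cong (↥ q *_) (ℚ.↧-/ x d) ⟨
    ↥ q * (↧ q * g)    ≡⟨ ℤ*.x∙yz≈xz∙y (↥ q) (↧ q) g ⟩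
    ↥ q * g * ↧ q      ≡⟨ cong (_* ↧ q) (ℚ.↥-/ x d) ⟩
    x * ↧ q            ∎)
    where
    q : ℚ
    q = x ℚ./ d
    g : ℤ
    g = ℤ.gcd x (+ d)

  isFraction-cong : ∀ {h N N′ d d′} .{{_ : NonZero d}} →
                    IsFraction h N d → N * + d′ ≡ N′ * + d → IsFraction h N′ d′
  isFraction-cong {h} {N} {N′} {d} {d′} (*≡* h≈N/d) N/d≈N′/d′ =
    *≡* (ℤ.*-cancelʳ-≡ _ _ (+ d) (begin
      ↥ h * + d′ * + d   ≡⟨ ℤ*.xy∙z≈xz∙y (↥ h) (+ d′) (+ d) ⟩
      ↥ h * + d * + d′   ≡⟨ cong (_* + d′) h≈N/d ⟩
      N * ↧ h * + d′     ≡⟨ ℤ*.xy∙z≈xz∙y N (↧ h) (+ d′) ⟩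
      N * + d′ * ↧ h     ≡⟨ cong (_* ↧ h) N/d≈N′/d′ ⟩
      N′ * + d * ↧ h     ≡⟨ ℤ*.xy∙z≈xz∙y N′ (+ d) (↧ h) ⟩
      N′ * ↧ h * + d     ∎))

  +-isFraction : ∀ {h k N M d e} → IsFraction h N d → IsFraction k M e →
                 IsFraction (h ℚ.+ k) (N * + e + M * + d) (d ℕ.* e)
  +-isFraction {h@record{}} {k@record{}} {N} {M} {d} {e} (*≡* h≈N/d) (*≡* k≈M/e) =
    isFraction-cong (/-isFraction S (↧ₙ h ℕ.* ↧ₙ k)) (begin
      S * + (d ℕ.* e)
        ≡⟨ cong (S *_) (ℤ.pos-* d e) ⟩
      S * (+ d * + e)
        ≡⟨ regroupˡ (↥ h) (↥ k) (↧ h) (↧ k) (+ d) (+ e) ⟩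
      ↥ h * + d * ↧ k * + e + ↥ k * + e * ↧ h * + d
        ≡⟨ cong₂ (λ u v → u * ↧ k * + e + v * ↧ h * + d) h≈N/d k≈M/e ⟩
      N * ↧ h * ↧ k * + e + M * ↧ k * ↧ h * + d
        ≡⟨ regroupʳ N M (↧ h) (↧ k) (+ d) (+ e) ⟩
      (N * + e + M * + d) * (↧ h * ↧ k)
        ≡⟨ cong ((N * + e + M * + d) *_) (ℤ.pos-* (↧ₙ h) (↧ₙ k)) ⟨
      (N * + e + M * + d) * + (↧ₙ h ℕ.* ↧ₙ k)
        ∎)
    where
    S : ℤ
    S = ↥ h * ↧ k + ↥ k * ↧ h
    regroupˡ : ∀ a b x y D E → (a * y + b * x) * (D * E) ≡ a * D * y * E + b * E * x * D
    regroupˡ = solve-∀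
    regroupʳ : ∀ N M x y D E → N * x * y * E + M * y * x * D ≡ (N * E + M * D) * (x * y)
    regroupʳ = solve-∀

  +-isFraction-common : ∀ {h k N M m i l a b} .{{_ : NonZero m}} .{{_ : NonZero i}} →
                        IsFraction h N m → IsFraction k M i → l ≡ m ℕ.* b → l ≡ i ℕ.* a →
                        IsFraction (h ℚ.+ k) (N * + b + M * + a) l
  +-isFraction-common {N = N} {M} {m} {i} {l} {a} {b} h≈N/m k≈M/i l≡m*b l≡i*a =
    isFraction-cong {{m*n≢0 m i}} (+-isFraction h≈N/m k≈M/i) (begin
      (N * + i + M * + m) * + l
        ≡⟨ ℤ.*-distribʳ-+ (+ l) (N * + i) (M * + m) ⟩
      N * + i * + l + M * + m * + l
        ≡⟨ cong₂ (λ u v → N * + i * u + M * + m * v) (pos-≡-* m b l≡m*b) (pos-≡-* i a l≡i*a) ⟩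
      N * + i * (+ m * + b) + M * + m * (+ i * + a)
        ≡⟨ regroup N M (+ i) (+ m) (+ a) (+ b) ⟩
      (N * + b + M * + a) * (+ m * + i)
        ≡⟨ cong ((N * + b + M * + a) *_) (ℤ.pos-* m i) ⟨
      (N * + b + M * + a) * + (m ℕ.* i)
        ∎)
    where
    pos-≡-* : ∀ {x} y z → x ≡ y ℕ.* z → + x ≡ + y * + z
    pos-≡-* y z x≡y*z = trans (cong +_ x≡y*z) (ℤ.pos-* y z)
    regroup : ∀ N M i m a b → N * i * (m * b) + M * m * (i * a) ≡ (N * b + M * a) * (m * i)
    regroup = solve-∀

  isFraction∧coprime⇒↧ₙ≡ : ∀ {h N d} → IsFraction h N d → Coprime ∣ N ∣ d → ↧ₙ h ≡ d
  isFraction∧coprime⇒↧ₙ≡ {mkℚ a _ a⊥↧h} {N} {d} (*≡* h≈N/d) N⊥d =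
    ∣-antisym (coprime-divisor (Coprimality.sym (Coprimality.recompute a⊥↧h)) (divides ∣ N ∣ cross))
              (coprime-divisor (Coprimality.sym N⊥d) (divides ∣ a ∣ (sym cross)))
    where
    cross : ∣ a ∣ ℕ.* d ≡ ∣ N ∣ ℕ.* _
    cross = trans (sym (ℤ.abs-* a (+ d))) (trans (cong ∣_∣ h≈N/d) (ℤ.abs-* N _))

module Arithmetic where

  open import Data.Nat as ℕ
    using (zero; suc; _*_; _^_; _∸_; _≤_; _<_; z≤n; s≤s; NonZero; NonTrivial)
  open import Data.Nat.Properties
  open import Data.Nat.Divisibility
    using ( _∣_; divides; divides-refl; _∣?_; ∣-trans; m∣m*n; n∣m*n; ∣m⇒∣m*n; 0∣⇒≡0; ∣1⇒≡1
          ; _∣0; 1∣_; *-monoˡ-∣; *-monoʳ-∣; *-cancelˡ-∣; m/n∣m; module ∣-Reasoning)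
  open import Data.Nat.DivMod using (_/_; m/n*n≡m)
  open import Data.Nat.GCD using (gcd; gcd[m,n]≢0; gcd[m,n]∣m; gcd[m,n]∣n)
  open import Data.Nat.LCM using (lcm; m∣lcm[m,n]; n∣lcm[m,n]; lcm-least; gcd*lcm)
  open import Data.Nat.Coprimality using (Coprime; coprime-/gcd)
  open import Data.Nat.Primality
  open import Data.Nat.Primality.Factorisation using (factorise)
  open import Data.Nat.Induction using (<-wellFounded)
  open import Algebra.Properties.CommutativeSemigroup *-commutativeSemigroup
  import Data.Integer.Properties as ℤ
  import Data.Integer.Divisibility.Signed as ℤˢ
  open ℤˢ using (∣ᵤ⇒∣; ∣⇒∣ᵤ)
  open import Data.Integer.Tactic.RingSolver using (solve-∀)
  open import Data.List using ([]; _∷_)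
  open import Data.List.Relation.Unary.All using (_∷_)
  open import Data.Product using (∃₂)
  open import Data.Sum using (_⊎_; inj₁; inj₂; [_,_]′)
  open import Data.Empty using (⊥)
  open import Induction.WellFounded using (Acc; acc)
  open import Relation.Nullary using (yes; no; contradiction)
  open import Relation.Nullary.Decidable using (_×-dec_; ¬?)
  open import Relation.Unary using (Decidable)
  open import Relation.Binary.PropositionalEquality

  prime-factor : ∀ d .{{_ : NonTrivial d}} → ∃ λ p → Prime p × p ∣ d
  prime-factor d with factorise d {{ℕ.nonTrivial⇒nonZero d}}
  ... | record { factors = [] ; isFactorisation = d≡1 } = contradiction d≡1 ℕ.nonTrivial⇒≢1
  ... | record { factors = p ∷ _ ; isFactorisation = d≡p*ps ; factorsPrime = prime-p ∷ _ } =
    p , prime-p , subst (p ∣_) (sym d≡p*ps) (m∣m*n _)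

  ¬common-prime⇒coprime : ∀ {m n} .{{_ : NonZero n}} →
                          (∀ {p} → Prime p → p ∣ m → p ∣ n → ⊥) → Coprime m n
  ¬common-prime⇒coprime {n = n} _ {zero} (_ , 0∣n) = contradiction (0∣⇒≡0 0∣n) (ℕ.≢-nonZero⁻¹ n)
  ¬common-prime⇒coprime _ {1} _ = refl
  ¬common-prime⇒coprime no-common {d@(suc (suc _))} (d∣m , d∣n) =
    let p , prime-p , p∣d = prime-factor d in
    contradiction (∣-trans p∣d d∣n) (no-common prime-p (∣-trans p∣d d∣m))

  coprime⇒¬common-prime : ∀ {m n p} → Coprime m n → Prime p → p ∣ m → p ∣ n → ⊥
  coprime⇒¬common-prime m⊥n prime-p p∣m p∣n =
    contradiction (subst Prime (m⊥n (p∣m , p∣n)) prime-p) ¬prime[1]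

  prime∣prime⇒≡ : ∀ {p q} → Prime p → Prime q → p ∣ q → p ≡ q
  prime∣prime⇒≡ prime-p prime-q p∣q with prime⇒irreducible prime-q p∣q
  ... | inj₁ p≡1 = contradiction (subst Prime p≡1 prime-p) ¬prime[1]
  ... | inj₂ p≡q = p≡q

  prime⇒¬∣1 : ∀ {p} → Prime p → ¬ p ∣ 1
  prime⇒¬∣1 prime-p p∣1 = contradiction (subst Prime (∣1⇒≡1 p∣1) prime-p) ¬prime[1]

  prime∣m*n∧∤n⇒∣m : ∀ {p} m n → Prime p → p ∣ m * n → ¬ p ∣ n → p ∣ m
  prime∣m*n∧∤n⇒∣m m n prime-p p∣mn p∤n with euclidsLemma m n prime-p p∣mn
  ... | inj₁ p∣m = p∣m
  ... | inj₂ p∣n = contradiction p∣n p∤n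

  prime∤m∧∤n⇒∤m*n : ∀ {p m n} → Prime p → ¬ p ∣ m → ¬ p ∣ n → ¬ p ∣ m * n
  prime∤m∧∤n⇒∤m*n {m = m} {n} prime-p p∤m p∤n p∣mn = p∤m (prime∣m*n∧∤n⇒∣m m n prime-p p∣mn p∤n)

  factor-power : ∀ {p} → 1 < p → ∀ k .{{_ : NonZero k}} → ∃₂ λ s u → k ≡ p ^ s * u × ¬ p ∣ u
  factor-power {p} 1<p k = go k (<-wellFounded k)
    where
    go : ∀ k .{{_ : NonZero k}} → Acc _<_ k → ∃₂ λ s u → k ≡ p ^ s * u × ¬ p ∣ u
    go k (acc rec) with p ∣? k
    ... | no p∤k = 0 , k , sym (*-identityˡ k) , p∤k
    ... | yes (divides-refl q) =
      let instance _ = m*n≢0⇒m≢0 q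
          s , u , q≡p^s*u , p∤u = go q (rec (m<m*n q p 1<p))
      in suc s , u , trans (cong (_* p) q≡p^s*u) (xy∙z≈zx∙y (p ^ s) u p) , p∤u

  ^-monoʳ-∣ : ∀ p {s t} → s ≤ t → p ^ s ∣ p ^ t
  ^-monoʳ-∣ p {s} {t} s≤t = divides (p ^ (t ∸ s)) (begin
    p ^ t                 ≡⟨ cong (p ^_) (m+[n∸m]≡n s≤t) ⟨
    p ^ (s ℕ.+ (t ∸ s))   ≡⟨ ^-distribˡ-+-* p s (t ∸ s) ⟩
    p ^ s * p ^ (t ∸ s)   ≡⟨ *-comm (p ^ s) _ ⟩
    p ^ (t ∸ s) * p ^ s   ∎)
    where open ≡-Reasoning

  module ℤᵤ where

    ∣m+n∣n⇒∣m : ∀ {k} m n → k ∣ᵤ m ℤ.+ n → k ∣ᵤ n → k ∣ᵤ m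
    ∣m+n∣n⇒∣m {k} m n k∣m+n k∣n =
      ∣⇒∣ᵤ {k} {m} (ℤˢ.∣m+n∣n⇒∣m (∣ᵤ⇒∣ {k} {m ℤ.+ n} k∣m+n) (∣ᵤ⇒∣ {k} {n} k∣n))

    ∣m+n∣m⇒∣n : ∀ {k} m n → k ∣ᵤ m ℤ.+ n → k ∣ᵤ m → k ∣ᵤ n
    ∣m+n∣m⇒∣n {k} m n k∣m+n k∣m =
      ∣⇒∣ᵤ {k} {n} (ℤˢ.∣m+n∣m⇒∣n (∣ᵤ⇒∣ {k} {m ℤ.+ n} k∣m+n) (∣ᵤ⇒∣ {k} {m} k∣m))

    ∣m∣n⇒∣m-n : ∀ {k} m n → k ∣ᵤ m → k ∣ᵤ n → k ∣ᵤ m - n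
    ∣m∣n⇒∣m-n {k} m n k∣m k∣n =
      ∣⇒∣ᵤ {k} {m - n} (ℤˢ.∣m∣n⇒∣m-n (∣ᵤ⇒∣ {k} {m} k∣m) (∣ᵤ⇒∣ {k} {n} k∣n))

    ∣n⇒∣m*n : ∀ {k} m n → k ∣ᵤ n → k ∣ᵤ m ℤ.* n
    ∣n⇒∣m*n m n k∣n = subst (_ ∣_) (sym (ℤ.abs-* m n)) (∣-trans k∣n (n∣m*n ℤ.∣ m ∣))

    prime∣m*n⇒∣m⊎∣n : ∀ m n {p} → Prime p → + p ∣ᵤ m ℤ.* n → + p ∣ᵤ m ⊎ + p ∣ᵤ n
    prime∣m*n⇒∣m⊎∣n m n prime-p p∣mn =
      euclidsLemma ℤ.∣ m ∣ ℤ.∣ n ∣ prime-p (subst (_ ∣_) (ℤ.abs-* m n) p∣mn)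

  prime∤-affine : ∀ {p} → Prime p → ∀ x a {c₁ c₂} → ¬ + p ∣ᵤ a → ¬ + p ∣ᵤ c₁ - c₂ →
                  ¬ + p ∣ᵤ x ℤ.+ c₁ ℤ.* a ⊎ ¬ + p ∣ᵤ x ℤ.+ c₂ ℤ.* a
  prime∤-affine {p} prime-p x a {c₁} {c₂} p∤a p∤c₁-c₂ with p ∣? ℤ.∣ x ℤ.+ c₁ ℤ.* a ∣
  ... | no p∤y₁ = inj₁ p∤y₁
  ... | yes p∣y₁ = inj₂ λ p∣y₂ →
    [ p∤c₁-c₂ , p∤a ]′ (ℤᵤ.prime∣m*n⇒∣m⊎∣n (c₁ - c₂) a prime-p (p∣[c₁-c₂]*a p∣y₂))
    where
    difference : ∀ x c₁ c₂ a → (x ℤ.+ c₁ ℤ.* a) - (x ℤ.+ c₂ ℤ.* a) ≡ (c₁ - c₂) ℤ.* a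
    difference = solve-∀
    p∣[c₁-c₂]*a : + p ∣ᵤ x ℤ.+ c₂ ℤ.* a → + p ∣ᵤ (c₁ - c₂) ℤ.* a
    p∣[c₁-c₂]*a p∣y₂ = subst (+ p ∣ᵤ_) (difference x c₁ c₂ a)
      (ℤᵤ.∣m∣n⇒∣m-n {+ p} (x ℤ.+ c₁ ℤ.* a) (x ℤ.+ c₂ ℤ.* a) p∣y₁ p∣y₂)

  module LcmCofactors (m n : ℕ) .{{_ : NonZero n}} where

    private instance
      gcd≢0 : NonZero (gcd m n)
      gcd≢0 = ℕ.≢-nonZero (gcd[m,n]≢0 m n (inj₂ (ℕ.≢-nonZero⁻¹ n)))

    α β : ℕ
    α = m / gcd m n
    β = n / gcd m n

    α∣m : α ∣ m
    α∣m = m/n∣m (gcd[m,n]∣m m n)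

    α-β-coprime : Coprime α β
    α-β-coprime = coprime-/gcd m n

    lcm≡m*β : lcm m n ≡ m * β
    lcm≡m*β = *-cancelˡ-≡ _ _ (gcd m n) (begin
      gcd m n * lcm m n      ≡⟨ gcd*lcm m n ⟩
      m * n                  ≡⟨ cong (m *_) (m/n*n≡m (gcd[m,n]∣n m n)) ⟨
      m * (β * gcd m n)      ≡⟨ x∙yz≈z∙xy m β (gcd m n) ⟩
      gcd m n * (m * β)      ∎)
      where open ≡-Reasoning

    lcm≡n*α : lcm m n ≡ n * α
    lcm≡n*α = *-cancelˡ-≡ _ _ (gcd m n) (begin
      gcd m n * lcm m n      ≡⟨ gcd*lcm m n ⟩
      m * n                  ≡⟨ cong (_* n) (m/n*n≡m (gcd[m,n]∣m m n)) ⟨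
      α * gcd m n * n        ≡⟨ xy∙z≈y∙zx α (gcd m n) n ⟩
      gcd m n * (n * α)      ∎)
      where open ≡-Reasoning

  lcmUpTo≢0 : ∀ n → NonZero (lcmUpTo n)
  lcmUpTo≢0 zero    = _
  lcmUpTo≢0 (suc n) = m*n≢0⇒n≢0 (gcd L (suc n)) {lcm L (suc n)} {{gcd*lcm≢0}}
    where
    L : ℕ
    L = lcmUpTo n
    gcd*lcm≢0 : NonZero (gcd L (suc n) * lcm L (suc n))
    gcd*lcm≢0 = subst NonZero (sym (gcd*lcm L (suc n))) (m*n≢0 L (suc n) {{lcmUpTo≢0 n}})

  ∣lcmUpTo : ∀ {k n} .{{_ : NonZero k}} → k ≤ n → k ∣ lcmUpTo n
  ∣lcmUpTo {k} {zero} k≤0 = contradiction (n≤0⇒n≡0 k≤0) (ℕ.≢-nonZero⁻¹ k)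
  ∣lcmUpTo {k} {suc n} k≤1+n with m≤n⇒m<n∨m≡n k≤1+n
  ... | inj₁ (s≤s k≤n) = ∣-trans (∣lcmUpTo k≤n) (m∣lcm[m,n] (lcmUpTo n) (suc n))
  ... | inj₂ refl      = n∣lcm[m,n] (lcmUpTo n) (suc n)

  lcmUpTo∣p^b* : ∀ {p} → Prime p → ∀ {b} n → n < p ^ suc b →
                 ∃ λ Q → ¬ p ∣ Q × lcmUpTo n ∣ p ^ b * Q
  lcmUpTo∣p^b* prime-p zero _ = 1 , prime⇒¬∣1 prime-p , 1∣ _
  lcmUpTo∣p^b* {p} prime-p {b} (suc n) 1+n<p^[1+b]
    with lcmUpTo∣p^b* prime-p {b} n (<-trans (n<1+n n) 1+n<p^[1+b])
       | factor-power (ℕ.nonTrivial⇒n>1 p {{prime⇒nonTrivial prime-p}}) (suc n)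
  ... | Q , p∤Q , L∣p^b*Q | s , u , 1+n≡p^s*u , p∤u =
    Q * u , prime∤m∧∤n⇒∤m*n prime-p p∤Q p∤u , lcm-least L∣p^b*Qu 1+n∣p^b*Qu
    where
    instance
      p≢0 : NonZero p
      p≢0 = prime⇒nonZero prime-p
      u≢0 : NonZero u
      u≢0 = ℕ.≢-nonZero λ u≡0 → p∤u (subst (p ∣_) (sym u≡0) (p ∣0))

    s≤b : s ≤ b
    s≤b = ≮⇒≥ λ b<s → <⇒≱ 1+n<p^[1+b] (begin
      p ^ suc b   ≤⟨ ^-monoʳ-≤ p b<s ⟩
      p ^ s       ≤⟨ m≤m*n (p ^ s) u ⟩
      p ^ s * u   ≡⟨ 1+n≡p^s*u ⟨
      suc n       ∎)
      where open ≤-Reasoning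

    L∣p^b*Qu : lcmUpTo n ∣ p ^ b * (Q * u)
    L∣p^b*Qu = subst (lcmUpTo n ∣_) (*-assoc (p ^ b) Q u) (∣m⇒∣m*n u L∣p^b*Q)

    1+n∣p^b*Qu : suc n ∣ p ^ b * (Q * u)
    1+n∣p^b*Qu = begin
      suc n           ≡⟨ 1+n≡p^s*u ⟩
      p ^ s * u       ∣⟨ *-monoˡ-∣ u (^-monoʳ-∣ p s≤b) ⟩
      p ^ b * u       ∣⟨ *-monoʳ-∣ (p ^ b) (n∣m*n Q) ⟩
      p ^ b * (Q * u) ∎
      where open ∣-Reasoning

  module Step (n : ℕ) where

    open LcmCofactors (lcmUpTo n) (suc n) public

    -- p is critical when n+1 carries the full power of p in lcmUpTo (n+1); these are the only
    -- primes that adding a term c / (n+1) can bring into the numerator.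
    Critical : ℕ → Set
    Critical p = Prime p × p ∣ suc n × ¬ p ∣ α

    critical? : Decidable Critical
    critical? p = prime? p ×-dec p ∣? suc n ×-dec ¬? (p ∣? α)

    -- With n+1 = e d, the number e p ≤ n+1 divides lcmUpTo (n+1) = e d α, so p ∣ d α.
    critical⇒∣-large-divisor : ∀ {p d} → Critical p → d ∣ suc n → p ≤ d → p ∣ d
    critical⇒∣-large-divisor {p} {d} (prime-p , _ , p∤α) (divides e 1+n≡e*d) p≤d =
      prime∣m*n∧∤n⇒∣m d α prime-p (*-cancelˡ-∣ e e*p∣e*[d*α]) p∤α
      where
      instance
        e≢0 : NonZero e
        e≢0 = m*n≢0⇒m≢0 e {{subst NonZero 1+n≡e*d _}}
        e*p≢0 : NonZero (e * p)
        e*p≢0 = m*n≢0 e p {{e≢0}} {{prime⇒nonZero prime-p}}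
      e*p∣e*[d*α] : e * p ∣ e * (d * α)
      e*p∣e*[d*α] = begin
        e * p            ∣⟨ ∣lcmUpTo (≤-trans (*-monoʳ-≤ e p≤d) (≤-reflexive (sym 1+n≡e*d))) ⟩
        lcmUpTo (suc n)  ≡⟨ lcm≡n*α ⟩
        suc n * α        ≡⟨ cong (_* α) 1+n≡e*d ⟩
        e * d * α        ≡⟨ *-assoc e d α ⟩
        e * (d * α)      ∎
        where open ∣-Reasoning

    critical-unique : ∀ {p q} → Critical p → Critical q → p ≡ q
    critical-unique {p} {q} cp@(prime-p , p∣1+n , _) cq@(prime-q , q∣1+n , _) with ≤-total p q
    ... | inj₁ p≤q = prime∣prime⇒≡ prime-p prime-q (critical⇒∣-large-divisor cp q∣1+n p≤q)
    ... | inj₂ q≤p = sym (prime∣prime⇒≡ prime-q prime-p (critical⇒∣-large-divisor cq p∣1+n q≤p))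

    prime-power⇒p∣β : ∀ {p b} → Prime p → suc n ≡ p ^ suc b → p ∣ β
    prime-power⇒p∣β {p} {b} prime-p 1+n≡p^[1+b] with p ∣? β
    ... | yes p∣β = p∣β
    ... | no p∤β with lcmUpTo∣p^b* prime-p {b} n (subst (n <_) 1+n≡p^[1+b] ≤-refl)
    ...   | Q , p∤Q , L∣p^b*Q = contradiction p∣Q*β (prime∤m∧∤n⇒∤m*n prime-p p∤Q p∤β)
      where
      instance
        p^b≢0 : NonZero (p ^ b)
        p^b≢0 = m^n≢0 p b {{prime⇒nonZero prime-p}}
      p^b*[p*α]∣p^b*[Q*β] : p ^ b * (p * α) ∣ p ^ b * (Q * β)
      p^b*[p*α]∣p^b*[Q*β] = begin
        p ^ b * (p * α)      ≡⟨ x∙yz≈yx∙z (p ^ b) p α ⟩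
        p ^ suc b * α        ≡⟨ cong (_* α) 1+n≡p^[1+b] ⟨
        suc n * α            ≡⟨ lcm≡n*α ⟨
        lcmUpTo (suc n)      ≡⟨ lcm≡m*β ⟩
        lcmUpTo n * β        ∣⟨ *-monoˡ-∣ β L∣p^b*Q ⟩
        p ^ b * Q * β        ≡⟨ *-assoc (p ^ b) Q β ⟩
        p ^ b * (Q * β)      ∎
        where open ∣-Reasoning
      p∣Q*β : p ∣ Q * β
      p∣Q*β = ∣-trans (m∣m*n α) (*-cancelˡ-∣ (p ^ b) p^b*[p*α]∣p^b*[Q*β])

    critical[2]⇒2∣β : Critical 2 → 2 ∣ β
    critical[2]⇒2∣β c2@(_ , 2∣1+n , _) with factor-power {2} (s≤s (s≤s z≤n)) (suc n)
    ... | _     , 0 , _         , 2∤u = contradiction (2 ∣0) 2∤u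
    ... | 0     , 1 , 1+n≡1     , _   =
      contradiction (subst (2 ∣_) 1+n≡1 2∣1+n) (prime⇒¬∣1 prime[2])
    ... | suc b , 1 , 1+n≡2^b*1 , _   =
      prime-power⇒p∣β {b = b} prime[2] (trans 1+n≡2^b*1 (*-identityʳ _))
    ... | a , u@(suc (suc _)) , 1+n≡2^a*u , 2∤u =
      contradiction (critical⇒∣-large-divisor c2 (divides (2 ^ a) 1+n≡2^a*u) (s≤s (s≤s z≤n))) 2∤u

    nextNumerator : ℤ → ℤ → ℤ
    nextNumerator N c = N ℤ.* + β ℤ.+ c ℤ.* + α

    Admissible : ℤ → ℤ → Set
    Admissible N c = ∀ {p} → Critical p → ¬ + p ∣ᵤ nextNumerator N c

    nextNumerator-coprime : ∀ N c → Coprime ℤ.∣ N ∣ (lcmUpTo n) → Admissible N c →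
                            Coprime ℤ.∣ nextNumerator N c ∣ (lcmUpTo (suc n))
    nextNumerator-coprime N c N⊥L admissible =
      ¬common-prime⇒coprime {{lcmUpTo≢0 (suc n)}} no-common-prime
      where
      no-common-prime : ∀ {q} → Prime q → + q ∣ᵤ nextNumerator N c → q ∣ lcmUpTo (suc n) → ⊥
      no-common-prime {q} prime-q q∣X q∣L′ with q ∣? α
      ... | no q∤α = admissible (prime-q , q∣1+n , q∤α) q∣X
        where
        q∣1+n : q ∣ suc n
        q∣1+n = prime∣m*n∧∤n⇒∣m (suc n) α prime-q (subst (q ∣_) lcm≡n*α q∣L′) q∤α
      ... | yes q∣α =
        [ (λ q∣N → coprime⇒¬common-prime N⊥L prime-q q∣N (∣-trans q∣α α∣m))
        , coprime⇒¬common-prime α-β-coprime prime-q q∣α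
        ]′ (ℤᵤ.prime∣m*n⇒∣m⊎∣n N (+ β) prime-q q∣N*β)
        where
        q∣N*β : + q ∣ᵤ N ℤ.* + β
        q∣N*β = ℤᵤ.∣m+n∣n⇒∣m {+ q} (N ℤ.* + β) (c ℤ.* + α) q∣X (ℤᵤ.∣n⇒∣m*n {+ q} c (+ α) q∣α)

    unique-critical⇒admissible : ∀ N c {p} → Critical p → ¬ + p ∣ᵤ nextNumerator N c →
                                 Admissible N c
    unique-critical⇒admissible N c cp p∤X cq =
      subst (λ q → ¬ + q ∣ᵤ nextNumerator N c) (critical-unique cp cq) p∤X

    critical[2]⇒odd : ∀ N c → ¬ + 2 ∣ᵤ c → Critical 2 → ¬ + 2 ∣ᵤ nextNumerator N c
    critical[2]⇒odd N c c-odd c2@(_ , _ , 2∤α) 2∣X =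
      [ c-odd , 2∤α ]′ (ℤᵤ.prime∣m*n⇒∣m⊎∣n c (+ α) prime[2] 2∣c*α)
      where
      2∣N*β : + 2 ∣ᵤ N ℤ.* + β
      2∣N*β = ℤᵤ.∣n⇒∣m*n {+ 2} N (+ β) (critical[2]⇒2∣β c2)
      2∣c*α : + 2 ∣ᵤ c ℤ.* + α
      2∣c*α = ℤᵤ.∣m+n∣m⇒∣n {+ 2} (N ℤ.* + β) (c ℤ.* + α) 2∣X 2∣N*β

    critical⇒one-of-two : ∀ N {p c₁ c₂} → Critical p → ¬ + p ∣ᵤ c₁ - c₂ →
                          ¬ + p ∣ᵤ nextNumerator N c₁ ⊎ ¬ + p ∣ᵤ nextNumerator N c₂
    critical⇒one-of-two N {c₁ = c₁} {c₂} (prime-p , _ , p∤α) =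
      prime∤-affine prime-p (N ℤ.* + β) (+ α) {c₁} {c₂} p∤α

module HarmonicSequence
  (A : ℤ → Set) {a₀ : ℤ} (a₀∈A : A a₀) (a₀-odd : ¬ + 2 ∣ᵤ a₀)
  (separating : (p : ℕ) → Prime p → p ≢ 2 → ∃ λ a₁ → ∃ λ a₂ → A a₁ × A a₂ × ¬ + p ∣ᵤ a₁ - a₂)
  where

  open import Data.Nat as ℕ using (zero; suc; s≤s)
  open import Data.Nat.Properties using (anyUpTo?)
  open import Data.Nat.Divisibility using (∣⇒≤; ∣1⇒≡1)
  open import Data.Nat.Coprimality using (Coprime)
  open import Data.Product using (proj₁; proj₂)
  open import Data.Sum using (inj₁; inj₂)
  open import Relation.Nullary using (yes; no)
  open import Relation.Binary.PropositionalEquality using (refl)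
  open Fraction using (IsFraction; *≡*; /-isFraction; +-isFraction-common; isFraction∧coprime⇒↧ₙ≡)
  open Arithmetic using (module Step; lcmUpTo≢0)

  module _ (n : ℕ) (N : ℤ) where

    open Step n

    admissible-for-critical : ∀ {p} → Critical p → ∃ λ c → A c × Admissible N c
    admissible-for-critical {p} cp with p ℕ.≟ 2
    ... | yes refl = a₀ , a₀∈A , unique-critical⇒admissible N a₀ cp (critical[2]⇒odd N a₀ a₀-odd cp)
    ... | no p≢2 with separating p (proj₁ cp) p≢2
    ...   | a₁ , a₂ , a₁∈A , a₂∈A , p∤a₁-a₂ with critical⇒one-of-two N {c₁ = a₁} {a₂} cp p∤a₁-a₂
    ...     | inj₁ p∤X₁ = a₁ , a₁∈A , unique-critical⇒admissible N a₁ cp p∤X₁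
    ...     | inj₂ p∤X₂ = a₂ , a₂∈A , unique-critical⇒admissible N a₂ cp p∤X₂

    admissible-choice : ∃ λ c → A c × Admissible N c
    admissible-choice with anyUpTo? critical? (suc (suc n))
    ... | yes (_ , _ , cp) = admissible-for-critical cp
    ... | no no-critical   =
      a₀ , a₀∈A , λ {p} cp _ → no-critical (p , s≤s (∣⇒≤ (proj₁ (proj₂ cp))) , cp)

  r : ℕ → ℤ
  numerator : ℕ → ℤ

  -- r 0 is never summed; it only has to lie in A.
  r zero    = a₀
  r (suc n) = proj₁ (admissible-choice n (numerator n))

  numerator zero    = + 0
  numerator (suc n) = Step.nextNumerator n (numerator n) (r (suc n))

  r∈A : ∀ i → A (r i)
  r∈A zero    = a₀∈A
  r∈A (suc n) = proj₁ (proj₂ (admissible-choice n (numerator n)))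

  numerator-coprime : ∀ n → Coprime ℤ.∣ numerator n ∣ (lcmUpTo n)
  numerator-coprime zero    (_ , d∣1) = ∣1⇒≡1 d∣1
  numerator-coprime (suc n) = Step.nextNumerator-coprime n (numerator n) (r (suc n))
    (numerator-coprime n) (proj₂ (proj₂ (admissible-choice n (numerator n))))

  harmonicSum-isFraction : ∀ n → IsFraction (harmonicSum r n) (numerator n) (lcmUpTo n)
  harmonicSum-isFraction zero    = *≡* refl
  harmonicSum-isFraction (suc n) = +-isFraction-common {{lcmUpTo≢0 n}}
    (harmonicSum-isFraction n) (/-isFraction (r (suc n)) (suc n)) lcm≡m*β lcm≡n*α
    where open Step n

  denominator≡lcmUpTo : ∀ n → ℚ.denominatorℕ (harmonicSum r n) ≡ lcmUpTo n
  denominator≡lcmUpTo n =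
    isFraction∧coprime⇒↧ₙ≡ (harmonicSum-isFraction n) (numerator-coprime n)

open import Data.Integer.Divisibility using (_∣_)

mainTheorem16 : (A : ℤ → Set) →
    (∃ λ a → A a × ¬ (+ 2 ∣ a)) →
    ((p : ℕ) → Prime p → p ≢ 2 →
      ∃ λ a₁ → ∃ λ a₂ → A a₁ × A a₂ × ¬ (+ p ∣ (a₁ - a₂))) →
    Σ (ℕ → ℤ) λ r → ((i : ℕ) → A (r i)) ×
      ((n : ℕ) → ℚ.denominatorℕ (harmonicSum r n) ≡ lcmUpTo n)
mainTheorem16 A (a₀ , a₀∈A , a₀-odd) separating = r , r∈A , denominator≡lcmUpTo
  where open HarmonicSequence A a₀∈A a₀-odd separating
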